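{- For every integer $b\geq 2$ there exist finite simple graphs $G$ and $H$ such that $\rho(G\square H)-\rho(G)\rho(H)=b$.
   Context: All graphs are finite and simple. For a graph $G$ and $v\in V(G)$, $N_G[v]$ is the closed neighborhood of $v$. A set $P\subseteq V(G)$ is a packing if $N_G[u]\cap N_G[v]=\emptyset$ for all distinct $u,v\in P$; the packing number $\rho(G)$ is the maximum cardinality of a packing. The Cartesian product $G\square H$ has vertex set $V(G)\times V(H)$, with $(g,h)$ adjacent to $(g',h')$ iff either $g=g'$ and $hh'\in E(H)$, or $h=h'$ and $gg'\in E(G)$. -}

module Defs where

open import Data.Nat using (ℕ; _*_; _≤_)
open import Data.Fin using (Fin; combine; quotient; remainder)
open import Data.Fin.Subset using (Subset; _∈_; ∣_∣)
open import Data.Product using (_×_)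
open import Data.Sum using (_⊎_)
open import Relation.Nullary using (¬_)
open import Relation.Binary.PropositionalEquality using (_≡_; _≢_)
open import Level using (0ℓ)
open import Relation.Binary using (Rel; Symmetric; Irreflexive)

record Graph : Set₁ where
  field
    n     : ℕ
    Adj   : Rel (Fin n) 0ℓ
    sym   : Symmetric Adj
    irr   : Irreflexive _≡_ Adj
open Graph public

InClosedNbhd : (G : Graph) → Fin (n G) → Fin (n G) → Set
InClosedNbhd G v w = (w ≡ v) ⊎ Adj G v w

IsPacking : (G : Graph) → Subset (n G) → Set
IsPacking G P = ∀ u v → u ∈ P → v ∈ P → u ≢ v →
  ∀ w → ¬ (InClosedNbhd G u w × InClosedNbhd G v w)

IsPackingNumber : Graph → ℕ → Set
IsPackingNumber G k =
  (Data.Product.Σ (Subset (n G)) λ P → IsPacking G P × ∣ P ∣ ≡ k)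
  × (∀ P → IsPacking G P → ∣ P ∣ ≤ k)

-- Cartesian product G □ H, vertex (g,h) encoded as combine g h : Fin (n G * n H)
_□_ : Graph → Graph → Graph
G □ H = record
  { n   = n G * n H
  ; Adj = λ x y → let g  = quotient {n G} (n H) x ; h  = remainder {n G} (n H) x
                      g' = quotient {n G} (n H) y ; h' = remainder {n G} (n H) y
                  in (g ≡ g' × Adj H h h') ⊎ (h ≡ h' × Adj G g g')
  ; sym = λ { (_⊎_.inj₁ (e , a)) → _⊎_.inj₁ (Relation.Binary.PropositionalEquality.sym e , Graph.sym H a)
            ; (_⊎_.inj₂ (e , a)) → _⊎_.inj₂ (Relation.Binary.PropositionalEquality.sym e , Graph.sym G a) }
  ; irr = λ { Relation.Binary.PropositionalEquality.refl (_⊎_.inj₁ (_ , a)) → Graph.irr H Relation.Binary.PropositionalEquality.refl a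
            ; Relation.Binary.PropositionalEquality.refl (_⊎_.inj₂ (_ , a)) → Graph.irr G Relation.Binary.PropositionalEquality.refl a }
  }
  where open Data.Product using (_,_)

-- Take G the star K₁,ₘ with m = |V(H)| leaves and H arbitrary. The vertices
-- (centre, h) dominate G □ H, so ρ(G □ H) ≤ m, while the diagonal
-- {(leaf h, h) : h ∈ V(H)} is a packing, so ρ(G □ H) = m = |V(H)|. As
-- ρ(G) = 1, the defect ρ(G □ H) − ρ(G)ρ(H) is |V(H)| − ρ(H), which is b for
-- H = K₁,b.
module Submission where

open import Defs hiding (sym)
open import Data.Nat using (ℕ; zero; suc; _+_; _*_; _≤_; _≥_; z≤n; s≤s)
open import Data.Nat.Properties using (*-identityˡ)
open import Data.Product using (Σ; ∃; _×_; _,_; proj₁; proj₂)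
open import Data.Sum using (_⊎_; inj₁; inj₂)
open import Data.Empty using (⊥-elim)
open import Data.Fin using (Fin; zero; suc; combine; quotient; remainder; punchOut)
open import Data.Fin.Properties
  using (combine-remQuot; remQuot-combine; punchOut-injective; suc-injective; 0≢1+n; _≟_)
open import Data.Fin.Subset using (Subset; _∈_; ∣_∣; ⁅_⁆; ⊥; inside; outside)
open import Data.Fin.Subset.Properties using (∣⁅x⁆∣≡1; x∈⁅y⁆⇒x≡y; ∉⊥; ∣⊥∣≡0)
open import Data.Vec using (Vec; []; _∷_; _++_; concat; tabulate; lookup; here; there)
open import Data.Vec.Properties using (lookup-concat; lookup∘tabulate; []=⇒lookup; lookup⇒[]=)
open import Relation.Nullary using (yes; no)
open import Relation.Binary.PropositionalEquality
  using (_≡_; _≢_; refl; sym; trans; cong; cong₂; subst; module ≡-Reasoning)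

∣p++q∣≡∣p∣+∣q∣ : ∀ {m k} (p : Subset m) (q : Subset k) → ∣ p ++ q ∣ ≡ ∣ p ∣ + ∣ q ∣
∣p++q∣≡∣p∣+∣q∣ []            q = refl
∣p++q∣≡∣p∣+∣q∣ (inside ∷ p)  q = cong suc (∣p++q∣≡∣p∣+∣q∣ p q)
∣p++q∣≡∣p∣+∣q∣ (outside ∷ p) q = ∣p++q∣≡∣p∣+∣q∣ p q

∣concat-singletons∣≡k : ∀ {m} k (f : Fin k → Subset m) →
  (∀ i → ∣ f i ∣ ≡ 1) → ∣ concat (tabulate f) ∣ ≡ k
∣concat-singletons∣≡k zero    f ∣f∣≡1 = refl
∣concat-singletons∣≡k (suc k) f ∣f∣≡1 = begin
  ∣ f zero ++ concat (tabulate (λ i → f (suc i))) ∣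
    ≡⟨ ∣p++q∣≡∣p∣+∣q∣ (f zero) _ ⟩
  ∣ f zero ∣ + ∣ concat (tabulate (λ i → f (suc i))) ∣
    ≡⟨ cong (_+ ∣ concat (tabulate (λ i → f (suc i))) ∣) (∣f∣≡1 zero) ⟩
  suc ∣ concat (tabulate (λ i → f (suc i))) ∣
    ≡⟨ cong suc (∣concat-singletons∣≡k k (λ i → f (suc i)) (λ i → ∣f∣≡1 (suc i))) ⟩
  suc k ∎
  where open ≡-Reasoning

-- Removing the first member, the remaining values avoid f 0, so punchOut
-- compresses them injectively into Fin k.
injective⇒∣p∣≤k : ∀ {m k} (p : Subset m) (f : ∀ u → u ∈ p → Fin k) →
  (∀ {u v} u∈p v∈p → f u u∈p ≡ f v v∈p → u ≡ v) → ∣ p ∣ ≤ k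
injective⇒∣p∣≤k [] f inj = z≤n
injective⇒∣p∣≤k (outside ∷ p) f inj =
  injective⇒∣p∣≤k p (λ u u∈p → f (suc u) (there u∈p))
    (λ u∈p v∈p e → suc-injective (inj (there u∈p) (there v∈p) e))
injective⇒∣p∣≤k {k = zero} (inside ∷ p) f inj with f zero here
... | ()
injective⇒∣p∣≤k {k = suc k} (inside ∷ p) f inj =
  s≤s (injective⇒∣p∣≤k p g λ u∈p v∈p e →
    suc-injective (inj (there u∈p) (there v∈p) (punchOut-injective (f0≢ u∈p) (f0≢ v∈p) e)))
  where
  f0≢ : ∀ {u} (u∈p : u ∈ p) → f zero here ≢ f (suc u) (there u∈p)
  f0≢ u∈p e = 0≢1+n (inj here (there u∈p) e)
  g : ∀ u → u ∈ p → Fin k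
  g u u∈p = punchOut (f0≢ u∈p)

Dominates : (G : Graph) {k : ℕ} → (Fin k → Fin (n G)) → Set
Dominates G {k} c = ∀ u → ∃ λ i → InClosedNbhd G u (c i)

∣packing∣≤domination : ∀ (G : Graph) {k} {c : Fin k → Fin (n G)} → Dominates G c →
  ∀ P → IsPacking G P → ∣ P ∣ ≤ k
∣packing∣≤domination G {c = c} dom P packing =
  injective⇒∣p∣≤k P (λ u _ → proj₁ (dom u)) injective
  where
  injective : ∀ {u v} → u ∈ P → v ∈ P → proj₁ (dom u) ≡ proj₁ (dom v) → u ≡ v
  injective {u} {v} u∈P v∈P e with u ≟ v
  ... | yes u≡v = u≡v
  ... | no  u≢v = ⊥-elim (packing u v u∈P v∈P u≢v (c (proj₁ (dom u)))
    (proj₂ (dom u) , subst (λ i → InClosedNbhd G v (c i)) (sym e) (proj₂ (dom v))))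

singleton-isPacking : ∀ (G : Graph) v → IsPacking G ⁅ v ⁆
singleton-isPacking G v x y x∈ y∈ x≢y _ _ = x≢y (trans (x∈⁅y⁆⇒x≡y v x∈) (sym (x∈⁅y⁆⇒x≡y v y∈)))

quotient-combine : ∀ {m k} (i : Fin m) (j : Fin k) → quotient {m} k (combine i j) ≡ i
quotient-combine i j = cong proj₁ (remQuot-combine i j)

remainder-combine : ∀ {m k} (i : Fin m) (j : Fin k) → remainder {m} k (combine i j) ≡ j
remainder-combine i j = cong proj₂ (remQuot-combine i j)

quotient-remainder-injective : ∀ {m k} {x y : Fin (m * k)} →
  quotient {m} k x ≡ quotient {m} k y → remainder {m} k x ≡ remainder {m} k y → x ≡ y
quotient-remainder-injective {m} {k} {x} {y} q≡ r≡ = begin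
  x                                                  ≡⟨ combine-remQuot {m} k x ⟨
  combine (quotient {m} k x) (remainder {m} k x)     ≡⟨ cong₂ combine q≡ r≡ ⟩
  combine (quotient {m} k y) (remainder {m} k y)     ≡⟨ combine-remQuot {m} k y ⟩
  y                                                  ∎
  where open ≡-Reasoning

□-dominates : ∀ (G H : Graph) {k} {c : Fin k → Fin (n G)} → Dominates G c →
  Dominates (G □ H) (λ i → combine (c (quotient {k} (n H) i)) (remainder {k} (n H) i))
□-dominates G H {k} {c} dom x with dom (quotient {n G} (n H) x)
... | i , cᵢ∈N[g] =
  combine i h , subst (InClosedNbhd (G □ H) x) (sym target≡) (closedNbhd cᵢ∈N[g])
  where
  h : Fin (n H)
  h = remainder {n G} (n H) x
  target≡ : combine (c (quotient {k} (n H) (combine i h))) (remainder {k} (n H) (combine i h))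
          ≡ combine (c i) h
  target≡ = cong₂ (λ i h → combine (c i) h) (quotient-combine i h) (remainder-combine i h)
  closedNbhd : InClosedNbhd G (quotient {n G} (n H) x) (c i) →
    InClosedNbhd (G □ H) x (combine (c i) h)
  closedNbhd (inj₁ cᵢ≡g) = inj₁ (quotient-remainder-injective {n G} {n H}
    (trans (quotient-combine (c i) h) cᵢ≡g) (remainder-combine (c i) h))
  closedNbhd (inj₂ g~cᵢ) = inj₂ (inj₂ (sym (remainder-combine (c i) h)
    , subst (Adj G _) (sym (quotient-combine (c i) h)) g~cᵢ))

data StarAdj {m : ℕ} : Fin (suc m) → Fin (suc m) → Set where
  centre-leaf : ∀ i → StarAdj zero (suc i)
  leaf-centre : ∀ i → StarAdj (suc i) zero

Star : ℕ → Graph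
Star m = record
  { n   = suc m
  ; Adj = StarAdj
  ; sym = λ { (centre-leaf i) → leaf-centre i ; (leaf-centre i) → centre-leaf i }
  ; irr = λ { refl () }
  }

leaf-adjacent⇒centre : ∀ {m} {x y : Fin (suc m)} {i} → x ≡ suc i → StarAdj x y → y ≡ zero
leaf-adjacent⇒centre () (centre-leaf _)
leaf-adjacent⇒centre _  (leaf-centre _) = refl

centre-dominates : ∀ m → Dominates (Star m) {1} (λ _ → zero)
centre-dominates m zero    = zero , inj₁ refl
centre-dominates m (suc i) = zero , inj₂ (leaf-centre i)

ρ-Star : ∀ m → IsPackingNumber (Star m) 1
ρ-Star m = (⁅ zero ⁆ , singleton-isPacking (Star m) zero , ∣⁅x⁆∣≡1 {suc m} zero)
         , ∣packing∣≤domination (Star m) (centre-dominates m)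

module _ (H : Graph) where

  private
    G : Graph
    G = Star (n H)

    q : Fin (n G * n H) → Fin (n G)
    q = quotient {n G} (n H)

    r : Fin (n G * n H) → Fin (n H)
    r = remainder {n G} (n H)

  -- Row g of the matrix V(G) × V(H): row 0 (the centre) is empty, row suc h is {h}.
  rows : Vec (Subset (n H)) (n G)
  rows = ⊥ ∷ tabulate ⁅_⁆

  diagonal : Subset (n (G □ H))
  diagonal = concat rows

  ∣diagonal∣ : ∣ diagonal ∣ ≡ n H
  ∣diagonal∣ = begin
    ∣ ⊥ {n H} ++ leafRows ∣        ≡⟨ ∣p++q∣≡∣p∣+∣q∣ (⊥ {n H}) leafRows ⟩
    ∣ ⊥ {n H} ∣ + ∣ leafRows ∣     ≡⟨ cong (_+ ∣ leafRows ∣) (∣⊥∣≡0 (n H)) ⟩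
    ∣ leafRows ∣                   ≡⟨ ∣concat-singletons∣≡k (n H) ⁅_⁆ ∣⁅x⁆∣≡1 ⟩
    n H                            ∎
    where
    open ≡-Reasoning
    leafRows : Subset (n H * n H)
    leafRows = concat (tabulate (⁅_⁆ {n H}))

  ∈diagonal⇒leaf : ∀ {u} → u ∈ diagonal → q u ≡ suc (r u)
  ∈diagonal⇒leaf {u} u∈ = row-entry (q u) (r u) (begin
    lookup (lookup rows (q u)) (r u)   ≡⟨ lookup-concat rows (q u) (r u) ⟨
    lookup diagonal (combine (q u) (r u))
                                       ≡⟨ cong (lookup diagonal) (combine-remQuot {n G} (n H) u) ⟩
    lookup diagonal u                  ≡⟨ []=⇒lookup u∈ ⟩
    inside                             ∎)
    where
    open ≡-Reasoning
    row-entry : ∀ g h → lookup (lookup rows g) h ≡ inside → g ≡ suc h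
    row-entry zero    h e = ⊥-elim (∉⊥ (lookup⇒[]= h ⊥ e))
    row-entry (suc g) h e rewrite lookup∘tabulate ⁅_⁆ g =
      cong suc (sym (x∈⁅y⁆⇒x≡y g (lookup⇒[]= h ⁅ g ⁆ e)))

  closedNbhd-of-leaf : ∀ u w → q u ≡ suc (r u) → InClosedNbhd (G □ H) u w →
    q w ≡ q u ⊎ (q w ≡ zero × r w ≡ r u)
  closedNbhd-of-leaf u w _    (inj₁ refl)                = inj₁ refl
  closedNbhd-of-leaf u w _    (inj₂ (inj₁ (q≡ , _)))     = inj₁ (sym q≡)
  closedNbhd-of-leaf u w leaf (inj₂ (inj₂ (r≡ , u~w)))   = inj₂ (leaf-adjacent⇒centre leaf u~w , sym r≡)

  diagonal-isPacking : IsPacking (G □ H) diagonal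
  diagonal-isPacking u v u∈ v∈ u≢v w (u~w , v~w)
    with leafᵤ ← ∈diagonal⇒leaf u∈ | leafᵥ ← ∈diagonal⇒leaf v∈
    with closedNbhd-of-leaf u w leafᵤ u~w | closedNbhd-of-leaf v w leafᵥ v~w
  ... | inj₁ qu | inj₁ qv = u≢v (quotient-remainder-injective {n G} {n H} qu≡qv
        (suc-injective (trans (sym leafᵤ) (trans qu≡qv leafᵥ))))
    where
    qu≡qv : q u ≡ q v
    qu≡qv = trans (sym qu) qv
  ... | inj₁ qu | inj₂ (q0 , _) = 0≢1+n (trans (sym q0) (trans qu leafᵤ))
  ... | inj₂ (q0 , _) | inj₁ qv = 0≢1+n (trans (sym q0) (trans qv leafᵥ))
  ... | inj₂ (_ , ru) | inj₂ (_ , rv) = u≢v (quotient-remainder-injective {n G} {n H}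
        (trans leafᵤ (trans (cong suc ru≡rv) (sym leafᵥ))) ru≡rv)
    where
    ru≡rv : r u ≡ r v
    ru≡rv = trans (sym ru) rv

  ρ-Star□ : IsPackingNumber (G □ H) (n H)
  ρ-Star□ = (diagonal , diagonal-isPacking , ∣diagonal∣)
          , λ P packing → subst (∣ P ∣ ≤_) (*-identityˡ (n H))
              (∣packing∣≤domination (G □ H) (□-dominates G H (centre-dominates (n H))) P packing)

proposition1 : (b : ℕ) → b ≥ 2 →
    Σ Graph λ G → Σ Graph λ H → Σ ℕ λ ρG → Σ ℕ λ ρH → Σ ℕ λ ρGH →
    IsPackingNumber G ρG × IsPackingNumber H ρH × IsPackingNumber (G □ H) ρGH
    × ρGH ≡ ρG * ρH + b
proposition1 b _ = Star (suc b) , Star b , 1 , 1 , suc b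
                 , ρ-Star (suc b) , ρ-Star b , ρ-Star□ (Star b) , refl
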